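{- Let $G=(V,E)$ be a graph without isolated vertices and $k$ a positive integer. Then there is a sequence of at most $k$ exclusive vertex splits transforming $G$ into a constellation if and only if there is a Star-decomposition $\mathcal{P}$ of $G$ with $\mathrm{wgt}(\mathcal{P})\le |V(G)|+k$.
   Context: All graphs are finite, simple and undirected. An exclusive vertex split of a vertex $v$ removes $v$ and adds two new vertices $v_1,v_2$ with $N(v_1)\cup N(v_2)=N(v)$ and $N(v_1)\cap N(v_2)=\emptyset$; no other adjacencies change. A star is a graph with a single central vertex adjacent to all other vertices; a constellation is a disjoint union of stars. A Star-decomposition of $G$ is a set $\mathcal{P}=\{H_1,\dots,H_l\}$ of subgraphs of $G$, each isomorphic to a star, whose edge sets partition $E(G)$; its weight is $\mathrm{wgt}(\mathcal{P})=\sum_{v\in V}|\{i: v\in V(H_i)\}|$. -}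

module Defs where

open import Data.Nat using (ℕ; zero; suc; _+_; _≤_)
open import Data.Fin using (Fin; zero; suc; _≟_)
open import Data.Fin.Subset using (Subset; ∣_∣)
open import Data.Vec using (lookup)
open import Data.Bool using (Bool; true; false; _∧_; _∨_; not; if_then_else_)
open import Data.List using (List; []; _∷_; length; filter; map; sum)
open import Data.Product using (Σ; ∃; _×_; _,_)
open import Data.Sum using (_⊎_)
open import Relation.Nullary using (¬_; does)
open import Relation.Binary.PropositionalEquality using (_≡_; _≢_)
open import Function.Bundles using (_⇔_)
open import Data.List.Relation.Unary.All using (All)

record Graph : Set where
  constructor mkGraph
  field
    n   : ℕ
    adj : Fin n → Fin n → Bool
open Graph public

IsSimple : Graph → Set
IsSimple G = (∀ x → adj G x x ≡ false) × (∀ x y → adj G x y ≡ adj G y x)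

NoIsolated : Graph → Set
NoIsolated G = ∀ v → ∃ λ u → adj G v u ≡ true

-- Splitting v in G (n vertices) with the set S: the new graph has
-- vertices Fin (suc n); old vertex x is  suc x , with  suc v  playing the
-- role of v₁ and the new vertex  zero  playing the role of v₂.
-- N(v₂) = N(v) ∩ S,  N(v₁) = N(v) \ S, so N(v₁) ∪ N(v₂) = N(v) and
-- N(v₁) ∩ N(v₂) = ∅; every exclusive split of v arises for some S.

splitAdj : (G : Graph) → Fin (n G) → Subset (n G) →
           Fin (suc (n G)) → Fin (suc (n G)) → Bool
splitAdj G v S zero    zero    = false
splitAdj G v S zero    (suc y) = adj G v y ∧ lookup S y
splitAdj G v S (suc x) zero    = adj G v x ∧ lookup S x
splitAdj G v S (suc x) (suc y) =
  if does (x ≟ v) then adj G v y ∧ not (lookup S y)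
  else if does (y ≟ v) then adj G x v ∧ not (lookup S x)
  else adj G x y

split : (G : Graph) → Fin (n G) → Subset (n G) → Graph
split G v S = mkGraph (suc (n G)) (splitAdj G v S)

data Splits : ℕ → Graph → Graph → Set where
  done : ∀ {G} → Splits 0 G G
  step : ∀ {m G H} (v : Fin (n G)) (S : Subset (n G)) →
         Splits m (split G v S) H → Splits (suc m) G H

-- Constellation: disjoint union of stars.  The function c sends each
-- vertex to the centre of the star containing it; the stars are the
-- fibres of c, and G is exactly the union of these stars.
IsConstellation : Graph → Set
IsConstellation G =
  Σ (Fin (n G) → Fin (n G)) λ c →
    (∀ x → c (c x) ≡ c x) ×
    (∀ x y → (adj G x y ≡ true) ⇔
               (x ≢ y × c x ≡ c y × (x ≡ c x ⊎ y ≡ c y)))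

record Star (n : ℕ) : Set where
  constructor mkStar
  field
    centre : Fin n
    leaves : Subset n
open Star public

IsStarIn : (G : Graph) → Star (n G) → Set
IsStarIn G s = (lookup (leaves s) (centre s) ≡ false) ×
               (∀ l → lookup (leaves s) l ≡ true → adj G (centre s) l ≡ true)

edgeIn : ∀ {n} → Star n → Fin n → Fin n → Bool
edgeIn s x y = (does (centre s ≟ x) ∧ lookup (leaves s) y)
             ∨ (does (centre s ≟ y) ∧ lookup (leaves s) x)

edgeMult : ∀ {n} → List (Star n) → Fin n → Fin n → ℕ
edgeMult []       x y = 0
edgeMult (s ∷ ss) x y = (if edgeIn s x y then 1 else 0) + edgeMult ss x y

IsStarDecomposition : (G : Graph) → List (Star (n G)) → Set
IsStarDecomposition G P =
  All (IsStarIn G) P ×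
  (∀ x y → adj G x y ≡ true → edgeMult P x y ≡ 1)

-- wgt(P) = Σ_i |V(H_i)|  (= Σ_v #{i : v ∈ V(H_i)})
wgt : ∀ {n} → List (Star n) → ℕ
wgt []       = 0
wgt (s ∷ ss) = suc ∣ leaves s ∣ + wgt ss

{-# OPTIONS --safe #-}

-- Let mult P u (vertexMult) be the number of stars of P containing u, so wgt P = Σᵤ mult P u.
-- A decomposition with mult ≡ 1 everywhere, i.e. of weight |V|, is the same thing as a
-- constellation: the star containing u names the centre of u.
-- The projection v₁, v₂ ↦ v of an exclusive split maps the edges of the split graph
-- bijectively onto those of the original one.  Pushing a decomposition forward along it
-- never increases the weight, so k splits ending in a constellation give weight ≤ |V| + k.
-- Conversely, as long as some v has mult ≥ 2, pick a star s₀ through v and split off its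
-- edges at v onto the new vertex v₂.  Lifting s₀ through v₂ and every other star through v₁
-- gives a decomposition of the split graph of the same weight, with one more vertex and all
-- multiplicities still positive; without isolated vertices they are positive at the start.
-- After wgt − |V| splits every multiplicity is 1.
module Submission where

open import Defs
open import Data.Nat using (ℕ; zero; suc; _+_; _∸_; _≤_; _<_; z≤n; s≤s; s≤s⁻¹; z<s; _<?_)
open import Data.Nat.Properties
  using ( module ≤-Reasoning; +-0-commutativeMonoid; suc-injective; n>0⇒n≢0
        ; +-identityʳ; +-suc; +-assoc; +-comm; ≤-refl; ≤-reflexive; ≤-trans; ≤-antisym; <-irrefl; ≮⇒≥
        ; +-mono-≤; +-monoˡ-≤; +-monoʳ-≤; +-cancelʳ-≤; m≤m+n; m≤n+m; m<m+n; m+[n∸m]≡n; m≤n+o⇒m∸n≤o )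
open import Data.Nat.ListAction using (sum)
open import Data.Nat.ListAction.Properties using (sum-++)
open import Algebra.Properties.CommutativeMonoid.Sum +-0-commutativeMonoid
  using (sum-syntax; sum-cong-≗; ∑-distrib-+; ∑-comm; sum-replicate-zero)
open import Data.Fin using (Fin; zero; suc)
open import Data.Fin.Properties using (_≟_; any?)
open import Data.Fin.Subset using (Subset; ∣_∣)
open import Data.Vec using ([]; _∷_; lookup; tabulate)
open import Data.Vec.Properties using (lookup∘tabulate)
open import Data.Bool using (Bool; true; false; _∧_; _∨_; not; if_then_else_)
open import Data.Bool.Properties
  using (∧-identityʳ; ∧-zeroʳ; ∧-comm; ∧-assoc; ∧-distribʳ-∨; ∨-comm; ∨-zeroʳ; ¬-not; ⇔→≡)
import Data.Bool.Properties as Bool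
open import Data.Bool.Solver using (module ∨-∧-Solver)
open ∨-∧-Solver using (solve; _:+_; _:*_; _:=_)
open import Data.List using (List; []; _∷_; _++_; map; filterᵇ)
import Data.List as List
open import Data.List.Properties using (map-++; map-id; map-∘)
open import Data.List.Relation.Unary.All using (All; []; _∷_)
import Data.List.Relation.Unary.All as All
import Data.List.Relation.Unary.All.Properties as All
open import Data.List.Relation.Unary.Any using (here; there)
open import Data.List.Membership.Propositional using (_∈_)
open import Data.List.Membership.Propositional.Properties using (∈-++⁺ˡ; ∈-++⁺ʳ; ∈-∃++)
open import Data.Product using (Σ; ∃; ∃₂; _×_; _,_; proj₁; proj₂; uncurry)
open import Data.Sum using (_⊎_; inj₁; inj₂)
open import Function using (id; _∘_; _⇔_; mk⇔; Equivalence)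
open import Relation.Nullary using (Dec; does; yes; no; _×-dec_; T?; contradiction)
open import Relation.Nullary.Decidable using (does-⇔; dec-true; dec-false)
open import Relation.Binary.PropositionalEquality

-- Indicators and finite sums

𝟙 : Bool → ℕ
𝟙 b = if b then 1 else 0

∧-true⁻ : ∀ {a b} → a ∧ b ≡ true → a ≡ true × b ≡ true
∧-true⁻ {true} {true} _ = refl , refl

∨-true⁻ : ∀ {a b} → a ∨ b ≡ true → a ≡ true ⊎ b ≡ true
∨-true⁻ {true}  _ = inj₁ refl
∨-true⁻ {false} b = inj₂ b

does-true⁻ : ∀ {A : Set} (a? : Dec A) → does a? ≡ true → A
does-true⁻ (yes a) _ = a

≟-sym : ∀ {n} (x y : Fin n) → does (x ≟ y) ≡ does (y ≟ x)
≟-sym x y = does-⇔ (mk⇔ sym sym) (x ≟ y) (y ≟ x)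

∑-mono-≤ : ∀ {n} {f g : Fin n → ℕ} → (∀ x → f x ≤ g x) → ∑[ x < n ] f x ≤ ∑[ x < n ] g x
∑-mono-≤ {zero}  _   = z≤n
∑-mono-≤ {suc n} f≤g = +-mono-≤ (f≤g zero) (∑-mono-≤ (f≤g ∘ suc))

term≤∑ : ∀ {n} (f : Fin n → ℕ) x → f x ≤ ∑[ y < n ] f y
term≤∑ f zero    = m≤m+n _ _
term≤∑ f (suc x) = ≤-trans (term≤∑ (f ∘ suc) x) (m≤n+m _ (f zero))

∑-1 : ∀ n → ∑[ x < n ] 1 ≡ n
∑-1 zero    = refl
∑-1 (suc n) = cong suc (∑-1 n)

∑-δ : ∀ {n} (y : Fin n) (b : Fin n → Bool) → ∑[ x < n ] 𝟙 (does (x ≟ y) ∧ b x) ≡ 𝟙 (b y)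
∑-δ {suc n} zero    b = trans (cong (𝟙 (b zero) +_) (sum-replicate-zero n)) (+-identityʳ _)
∑-δ {suc n} (suc y) b = ∑-δ y (b ∘ suc)

∑-δʳ : ∀ {n} (y : Fin n) (b : Fin n → Bool) → ∑[ x < n ] 𝟙 (does (y ≟ x) ∧ b x) ≡ 𝟙 (b y)
∑-δʳ y b = trans (sum-cong-≗ (λ x → cong (λ d → 𝟙 (d ∧ b x)) (≟-sym y x))) (∑-δ y b)

∑-𝟙≟ : ∀ {n} (y : Fin n) → ∑[ x < n ] 𝟙 (does (x ≟ y)) ≡ 1
∑-𝟙≟ y = trans (sum-cong-≗ (λ x → cong 𝟙 (sym (∧-identityʳ (does (x ≟ y)))))) (∑-δ y (λ _ → true))

∑-𝟙≟ʳ : ∀ {n} (y : Fin n) → ∑[ x < n ] 𝟙 (does (y ≟ x)) ≡ 1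
∑-𝟙≟ʳ y = trans (sum-cong-≗ (λ x → cong 𝟙 (≟-sym y x))) (∑-𝟙≟ y)

∣p∣≡∑ : ∀ {n} (p : Subset n) → ∣ p ∣ ≡ ∑[ x < n ] 𝟙 (lookup p x)
∣p∣≡∑ []          = refl
∣p∣≡∑ (true ∷ p)  = cong suc (∣p∣≡∑ p)
∣p∣≡∑ (false ∷ p) = ∣p∣≡∑ p

n≤∑ : ∀ {n} (f : Fin n → ℕ) → (∀ x → 1 ≤ f x) → n ≤ ∑[ x < n ] f x
n≤∑ {zero}  f _   = z≤n
n≤∑ {suc n} f f≥1 = +-mono-≤ (f≥1 zero) (n≤∑ (f ∘ suc) (f≥1 ∘ suc))

n<∑ : ∀ {n} (f : Fin n → ℕ) → (∀ x → 1 ≤ f x) → ∀ y → 1 < f y → n < ∑[ x < n ] f x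
n<∑ f f≥1 zero    f0>1 = +-mono-≤ f0>1 (n≤∑ (f ∘ suc) (f≥1 ∘ suc))
n<∑ f f≥1 (suc y) fy>1 = +-mono-≤ (f≥1 zero) (n<∑ (f ∘ suc) (f≥1 ∘ suc) y fy>1)

∑≡n⇒≡1 : ∀ {n} (f : Fin n → ℕ) → (∀ x → 1 ≤ f x) → ∑[ x < n ] f x ≡ n → ∀ x → f x ≡ 1
∑≡n⇒≡1 {n} f f≥1 ∑≡n x = ≤-antisym (≮⇒≥ λ fx>1 → <-irrefl (sym ∑≡n) (n<∑ f f≥1 x fx>1)) (f≥1 x)

n<∑⇒∃>1 : ∀ {n} (f : Fin n → ℕ) → n < ∑[ x < n ] f x → ∃ λ x → 1 < f x
n<∑⇒∃>1 {suc n} f n<∑f with 1 <? f zero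
... | yes f0>1 = zero , f0>1
... | no  f0≯1 with n<∑⇒∃>1 (f ∘ suc) (s≤s⁻¹ (≤-trans n<∑f (+-monoˡ-≤ _ (≮⇒≥ f0≯1))))
...   | x , fx>1 = suc x , fx>1

module _ {A : Set} where

  sum-map-++ : ∀ (f : A → ℕ) xs ys → sum (map f (xs ++ ys)) ≡ sum (map f xs) + sum (map f ys)
  sum-map-++ f xs ys = trans (cong sum (map-++ f xs ys)) (sum-++ (map f xs) (map f ys))

  ∈⇒≤sum-map : ∀ (f : A → ℕ) {x xs} → x ∈ xs → f x ≤ sum (map f xs)
  ∈⇒≤sum-map f (here refl) = m≤m+n _ _
  ∈⇒≤sum-map f {xs = y ∷ _} (there x∈xs) = ≤-trans (∈⇒≤sum-map f x∈xs) (m≤n+m _ (f y))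

  sum-map-𝟙⇒∃ : ∀ (p : A → Bool) xs → 1 ≤ sum (map (𝟙 ∘ p) xs) → ∃ λ x → x ∈ xs × p x ≡ true
  sum-map-𝟙⇒∃ p (x ∷ xs) pos with p x in px
  ... | true  = x , here refl , px
  ... | false with sum-map-𝟙⇒∃ p xs pos
  ...   | y , y∈xs , py = y , there y∈xs , py

  sum-map-𝟙-filter-tabulate : ∀ {n} (p q : A → Bool) (g : Fin n → A) →
                              sum (map (𝟙 ∘ q) (filterᵇ p (List.tabulate g))) ≡ ∑[ i < n ] 𝟙 (p (g i) ∧ q (g i))
  sum-map-𝟙-filter-tabulate {zero}  p q g = refl
  sum-map-𝟙-filter-tabulate {suc n} p q g with p (g zero)
  ... | true  = cong (𝟙 (q (g zero)) +_) (sum-map-𝟙-filter-tabulate p q (g ∘ suc))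
  ... | false = sum-map-𝟙-filter-tabulate p q (g ∘ suc)

-- Stars and multiplicities

vertexIn : ∀ {n} → Star n → Fin n → Bool
vertexIn s u = does (centre s ≟ u) ∨ lookup (leaves s) u

vertexMult : ∀ {n} → List (Star n) → Fin n → ℕ
vertexMult P u = sum (map (λ s → 𝟙 (vertexIn s u)) P)

edgeMult≡sum : ∀ {n} (P : List (Star n)) x y → edgeMult P x y ≡ sum (map (λ s → 𝟙 (edgeIn s x y)) P)
edgeMult≡sum []      x y = refl
edgeMult≡sum (s ∷ P) x y = cong (𝟙 (edgeIn s x y) +_) (edgeMult≡sum P x y)

edgeIn-sym : ∀ {n} (s : Star n) x y → edgeIn s x y ≡ edgeIn s y x
edgeIn-sym s x y = ∨-comm (does (centre s ≟ x) ∧ lookup (leaves s) y) _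

edgeMult-sym : ∀ {n} (P : List (Star n)) x y → edgeMult P x y ≡ edgeMult P y x
edgeMult-sym []      x y = refl
edgeMult-sym (s ∷ P) x y = cong₂ _+_ (cong 𝟙 (edgeIn-sym s x y)) (edgeMult-sym P x y)

edgeIn⁺ : ∀ {n} (s : Star n) {x y} → centre s ≡ x → lookup (leaves s) y ≡ true → edgeIn s x y ≡ true
edgeIn⁺ s {x} refl y∈L rewrite dec-true (centre s ≟ x) refl | y∈L = refl

edgeIn⁻ : ∀ {n} (s : Star n) {x y} → edgeIn s x y ≡ true →
          (centre s ≡ x × lookup (leaves s) y ≡ true) ⊎ (centre s ≡ y × lookup (leaves s) x ≡ true)
edgeIn⁻ s e with ∨-true⁻ e
... | inj₁ e₁ = let c≡x , y∈L = ∧-true⁻ e₁ in inj₁ (does-true⁻ (centre s ≟ _) c≡x , y∈L)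
... | inj₂ e₂ = let c≡y , x∈L = ∧-true⁻ e₂ in inj₂ (does-true⁻ (centre s ≟ _) c≡y , x∈L)

edgeIn⇒vertexIn : ∀ {n} (s : Star n) x y → edgeIn s x y ≡ true → vertexIn s x ≡ true
edgeIn⇒vertexIn s x y e with edgeIn⁻ s e
... | inj₁ (c≡x , _)   rewrite dec-true (centre s ≟ x) c≡x = refl
... | inj₂ (_   , x∈L) rewrite x∈L = ∨-zeroʳ _

vertexIn-centre : ∀ {n} (s : Star n) → vertexIn s (centre s) ≡ true
vertexIn-centre s rewrite dec-true (centre s ≟ centre s) refl = refl

vertexIn-leaf : ∀ {n} (s : Star n) {u} → vertexIn s u ≡ true → centre s ≢ u → lookup (leaves s) u ≡ true
vertexIn-leaf s {u} u∈s c≢u rewrite dec-false (centre s ≟ u) c≢u = u∈s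

edgeMult≤vertexMult : ∀ {n} (P : List (Star n)) x y → edgeMult P x y ≤ vertexMult P x
edgeMult≤vertexMult []      x y = z≤n
edgeMult≤vertexMult (s ∷ P) x y = +-mono-≤ (𝟙-mono (edgeIn⇒vertexIn s x y)) (edgeMult≤vertexMult P x y)
  where
  𝟙-mono : ∀ {a b} → (a ≡ true → b ≡ true) → 𝟙 a ≤ 𝟙 b
  𝟙-mono {false} _   = z≤n
  𝟙-mono {true}  a⇒b rewrite a⇒b refl = ≤-refl

CentreNotLeaf : ∀ {n} → Star n → Set
CentreNotLeaf s = lookup (leaves s) (centre s) ≡ false

∑-vertexIn : ∀ {n} (s : Star n) → CentreNotLeaf s → ∑[ u < n ] 𝟙 (vertexIn s u) ≡ suc ∣ leaves s ∣
∑-vertexIn {n} s c∉L = begin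
  ∑[ u < n ] 𝟙 (vertexIn s u)
    ≡⟨ sum-cong-≗ disjoint ⟩
  ∑[ u < n ] (𝟙 (does (centre s ≟ u)) + 𝟙 (lookup (leaves s) u))
    ≡⟨ ∑-distrib-+ (λ u → 𝟙 (does (centre s ≟ u))) (λ u → 𝟙 (lookup (leaves s) u)) ⟩
  ∑[ u < n ] 𝟙 (does (centre s ≟ u)) + ∑[ u < n ] 𝟙 (lookup (leaves s) u)
    ≡⟨ cong₂ _+_ (∑-𝟙≟ʳ (centre s)) (sym (∣p∣≡∑ (leaves s))) ⟩
  suc ∣ leaves s ∣
    ∎
  where
  open ≡-Reasoning
  disjoint : ∀ u → 𝟙 (vertexIn s u) ≡ 𝟙 (does (centre s ≟ u)) + 𝟙 (lookup (leaves s) u)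
  disjoint u with centre s ≟ u
  ... | yes refl rewrite c∉L = refl
  ... | no  _    = refl

∑-vertexMult≡wgt : ∀ {n} (P : List (Star n)) → All CentreNotLeaf P → ∑[ u < n ] vertexMult P u ≡ wgt P
∑-vertexMult≡wgt {n} []      []           = sum-replicate-zero n
∑-vertexMult≡wgt     (s ∷ P) (c∉L ∷ c∉Ls) =
  trans (∑-distrib-+ (λ u → 𝟙 (vertexIn s u)) (vertexMult P)) (cong₂ _+_ (∑-vertexIn s c∉L) (∑-vertexMult≡wgt P c∉Ls))

vertexMult-++ : ∀ {n} (xs ys : List (Star n)) u → vertexMult (xs ++ ys) u ≡ vertexMult xs u + vertexMult ys u
vertexMult-++ xs ys u = sum-map-++ (λ s → 𝟙 (vertexIn s u)) xs ys

edgeMult-++ : ∀ {n} (xs ys : List (Star n)) x y → edgeMult (xs ++ ys) x y ≡ edgeMult xs x y + edgeMult ys x y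
edgeMult-++ xs ys x y = trans (edgeMult≡sum (xs ++ ys) x y)
  (trans (sum-map-++ (λ s → 𝟙 (edgeIn s x y)) xs ys) (sym (cong₂ _+_ (edgeMult≡sum xs x y) (edgeMult≡sum ys x y))))

edgeMult-map : ∀ {A : Set} {m n} (f : A → Star m) (g : A → Star n) {x y x′ y′} {qs} →
               All (λ q → edgeIn (f q) x y ≡ edgeIn (g q) x′ y′) qs →
               edgeMult (map f qs) x y ≡ edgeMult (map g qs) x′ y′
edgeMult-map f g []         = refl
edgeMult-map f g (e ∷ eqs) = cong₂ _+_ (cong 𝟙 e) (edgeMult-map f g eqs)

Loopless : Graph → Set
Loopless G = ∀ x → adj G x x ≡ false

adj⇒≢ : ∀ {G} → Loopless G → ∀ {x y} → adj G x y ≡ true → x ≢ y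
adj⇒≢ loopless {x} xy refl with () ← trans (sym xy) (loopless x)

Undirected : Graph → Set
Undirected G = ∀ x y → adj G x y ≡ adj G y x

edgeIn⇒adj : ∀ {G} → Undirected G → ∀ s → IsStarIn G s → ∀ {x y} → edgeIn s x y ≡ true → adj G x y ≡ true
edgeIn⇒adj undirected s (_ , leaf⇒adj) e with edgeIn⁻ s e
... | inj₁ (refl , y∈L) = leaf⇒adj _ y∈L
... | inj₂ (refl , x∈L) = trans (undirected _ _) (leaf⇒adj _ x∈L)

decomposition-∑vertexMult : ∀ {G P} → IsStarDecomposition G P → ∑[ u < n G ] vertexMult P u ≡ wgt P
decomposition-∑vertexMult {P = P} (stars , _) = ∑-vertexMult≡wgt P (All.map proj₁ stars)

noIsolated⇒covered : ∀ {G} → NoIsolated G → ∀ {P} → IsStarDecomposition G P → ∀ u → 1 ≤ vertexMult P u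
noIsolated⇒covered noIsolated {P} (_ , mult≡1) u =
  let w , uw = noIsolated u in ≤-trans (≤-reflexive (sym (mult≡1 u w uw))) (edgeMult≤vertexMult P u w)

covered⇒n≤wgt : ∀ {G P} → IsStarDecomposition G P → (∀ u → 1 ≤ vertexMult P u) → n G ≤ wgt P
covered⇒n≤wgt {G} {P} decomposition covered =
  subst (n G ≤_) (decomposition-∑vertexMult decomposition) (n≤∑ (vertexMult P) covered)

n<wgt⇒shared : ∀ {G P} → IsStarDecomposition G P → n G < wgt P → ∃ λ v → 1 < vertexMult P v
n<wgt⇒shared {G} {P} decomposition n<wgt =
  n<∑⇒∃>1 (vertexMult P) (subst (n G <_) (sym (decomposition-∑vertexMult decomposition)) n<wgt)

decomposition⇒edgeIn : ∀ {G P} → IsStarDecomposition G P → ∀ {x y} → adj G x y ≡ true →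
                        ∃ λ s → s ∈ P × edgeIn s x y ≡ true
decomposition⇒edgeIn {P = P} (_ , mult≡1) {x} {y} e =
  sum-map-𝟙⇒∃ (λ s → edgeIn s x y) P (≤-reflexive (trans (sym (mult≡1 x y e)) (edgeMult≡sum P x y)))

-- Transporting decompositions along edge bijections

record EdgeBijection (G′ G : Graph) : Set where
  field
    π           : Fin (n G′) → Fin (n G)
    π-adj       : ∀ {a b} → adj G′ a b ≡ true → adj G (π a) (π b) ≡ true
    lift        : ∀ {x y} → adj G x y ≡ true → ∃₂ λ a b → adj G′ a b ≡ true × π a ≡ x × π b ≡ y
    lift-unique : ∀ {a b a′ b′} → adj G′ a b ≡ true → adj G′ a′ b′ ≡ true →
                  π a ≡ π a′ → π b ≡ π b′ → a ≡ a′ × b ≡ b′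

module Pushforward {G′ G} (β : EdgeBijection G′ G) (loopless : Loopless G) (undirected′ : Undirected G′) where
  open EdgeBijection β

  image : Subset (n G′) → Subset (n G)
  image L = tabulate λ x → does (any? λ a → (lookup L a Bool.≟ true) ×-dec (π a ≟ x))

  image⁺ : ∀ L {a} → lookup L a ≡ true → lookup (image L) (π a) ≡ true
  image⁺ L {a} a∈L = trans (lookup∘tabulate _ (π a)) (dec-true (any? _) (a , a∈L , refl))

  image⁻ : ∀ L {x} → lookup (image L) x ≡ true → ∃ λ a → lookup L a ≡ true × π a ≡ x
  image⁻ L {x} x∈img = does-true⁻ (any? _) (trans (sym (lookup∘tabulate _ x)) x∈img)

  ∣image∣≤ : ∀ L → ∣ image L ∣ ≤ ∣ L ∣
  ∣image∣≤ L = begin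
    ∣ image L ∣
      ≡⟨ ∣p∣≡∑ (image L) ⟩
    ∑[ x < n G ] 𝟙 (lookup (image L) x)
      ≤⟨ ∑-mono-≤ fibre-nonempty ⟩
    ∑[ x < n G ] ∑[ a < n G′ ] 𝟙 (does (π a ≟ x) ∧ lookup L a)
      ≡⟨ ∑-comm (λ x a → 𝟙 (does (π a ≟ x) ∧ lookup L a)) ⟩
    ∑[ a < n G′ ] ∑[ x < n G ] 𝟙 (does (π a ≟ x) ∧ lookup L a)
      ≡⟨ sum-cong-≗ (λ a → ∑-δʳ (π a) (λ _ → lookup L a)) ⟩
    ∑[ a < n G′ ] 𝟙 (lookup L a)
      ≡⟨ ∣p∣≡∑ L ⟨
    ∣ L ∣
      ∎
    where
    open ≤-Reasoning
    fibre-nonempty : ∀ x → 𝟙 (lookup (image L) x) ≤ ∑[ a < n G′ ] 𝟙 (does (π a ≟ x) ∧ lookup L a)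
    fibre-nonempty x with lookup (image L) x in x∈img
    ... | false = z≤n
    ... | true with image⁻ L x∈img
    ...   | a , a∈L , πa≡x =
      ≤-trans (≤-reflexive (cong 𝟙 (sym hit))) (term≤∑ (λ a → 𝟙 (does (π a ≟ x) ∧ lookup L a)) a)
      where
      hit : does (π a ≟ x) ∧ lookup L a ≡ true
      hit rewrite dec-true (π a ≟ x) πa≡x = a∈L

  push : Star (n G′) → Star (n G)
  push s = mkStar (π (centre s)) (image (leaves s))

  push-isStarIn : ∀ {s} → IsStarIn G′ s → IsStarIn G (push s)
  push-isStarIn {s} (c∉L , leaf⇒adj) = ¬-not centre-in-image , leaf⇒adj′
    where
    centre-in-image : lookup (image (leaves s)) (π (centre s)) ≢ true
    centre-in-image c∈img with image⁻ (leaves s) c∈img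
    ... | a , a∈L , πa≡πc with () ← trans (sym (loopless (π (centre s))))
                                       (subst (λ z → adj G (π (centre s)) z ≡ true) πa≡πc (π-adj (leaf⇒adj a a∈L)))
    leaf⇒adj′ : ∀ x → lookup (image (leaves s)) x ≡ true → adj G (π (centre s)) x ≡ true
    leaf⇒adj′ x x∈img with image⁻ (leaves s) x∈img
    ... | a , a∈L , refl = π-adj (leaf⇒adj a a∈L)

  edgeIn-push : ∀ {s} → IsStarIn G′ s → ∀ {a b} → adj G′ a b ≡ true → edgeIn (push s) (π a) (π b) ≡ edgeIn s a b
  edgeIn-push {s} (_ , leaf⇒adj) {a} {b} ab = ⇔→≡ {z = true} (mk⇔ reflect preserve)
    where
    preserve : edgeIn s a b ≡ true → edgeIn (push s) (π a) (π b) ≡ true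
    preserve e with edgeIn⁻ s e
    ... | inj₁ (c≡a , b∈L) = edgeIn⁺ (push s) (cong π c≡a) (image⁺ (leaves s) b∈L)
    ... | inj₂ (c≡b , a∈L) =
      trans (edgeIn-sym (push s) (π a) (π b)) (edgeIn⁺ (push s) (cong π c≡b) (image⁺ (leaves s) a∈L))
    reflect : edgeIn (push s) (π a) (π b) ≡ true → edgeIn s a b ≡ true
    reflect e with edgeIn⁻ (push s) e
    ... | inj₁ (πc≡πa , πb∈img) with image⁻ (leaves s) πb∈img
    ...   | b′ , b′∈L , πb′≡πb with lift-unique (leaf⇒adj b′ b′∈L) ab πc≡πa πb′≡πb
    ...     | c≡a , refl = edgeIn⁺ s c≡a b′∈L
    reflect e | inj₂ (πc≡πb , πa∈img) with image⁻ (leaves s) πa∈img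
    ...   | a′ , a′∈L , πa′≡πa
            with lift-unique (trans (undirected′ a′ _) (leaf⇒adj a′ a′∈L)) ab πa′≡πa πc≡πb
    ...     | refl , c≡b = trans (edgeIn-sym s a b) (edgeIn⁺ s c≡b a′∈L)

  push-decomposition : ∀ {P} → IsStarDecomposition G′ P → IsStarDecomposition G (map push P)
  push-decomposition {P} (stars , mult≡1) = All.map⁺ (All.map (λ {s} → push-isStarIn {s}) stars) , mult≡1′
    where
    mult≡1′ : ∀ x y → adj G x y ≡ true → edgeMult (map push P) x y ≡ 1
    mult≡1′ x y xy with lift xy
    ... | a , b , ab , refl , refl = begin
      edgeMult (map push P) (π a) (π b) ≡⟨ edgeMult-map push id (All.map (λ {s} st → edgeIn-push {s} st ab) stars) ⟩
      edgeMult (map id P) a b           ≡⟨ cong (λ Q → edgeMult Q a b) (map-id P) ⟩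
      edgeMult P a b                    ≡⟨ mult≡1 a b ab ⟩
      1                                 ∎
      where open ≡-Reasoning

  wgt-push : ∀ P → wgt (map push P) ≤ wgt P
  wgt-push []      = z≤n
  wgt-push (s ∷ P) = +-mono-≤ (s≤s (∣image∣≤ (leaves s))) (wgt-push P)

module Pullback {G′ G} (β : EdgeBijection G′ G) (undirected′ : Undirected G′) where
  open EdgeBijection β

  record Section : Set where
    constructor section
    field
      ι   : Fin (n G) → Fin (n G′)
      π∘ι : ∀ x → π (ι x) ≡ x
  open Section

  onImage : Section → Fin (n G′) → Bool
  onImage σ a = does (ι σ (π a) ≟ a)

  liftStar : Section → Star (n G) → Star (n G′)
  liftStar σ s = mkStar (ι σ (centre s)) (tabulate λ a → lookup (leaves s) (π a) ∧ onImage σ a)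

  onImage-ι : ∀ σ x → onImage σ (ι σ x) ≡ true
  onImage-ι σ x = dec-true (ι σ (π (ι σ x)) ≟ ι σ x) (cong (ι σ) (π∘ι σ x))

  ι≟ : ∀ σ x a → does (ι σ x ≟ a) ≡ does (x ≟ π a) ∧ onImage σ a
  ι≟ σ x a = does-⇔ (mk⇔ to from) (ι σ x ≟ a) ((x ≟ π a) ×-dec (ι σ (π a) ≟ a))
    where
    to : ι σ x ≡ a → x ≡ π a × ι σ (π a) ≡ a
    to refl = sym (π∘ι σ x) , cong (ι σ) (π∘ι σ x)
    from : x ≡ π a × ι σ (π a) ≡ a → ι σ x ≡ a
    from (refl , ιπa≡a) = ιπa≡a

  edgeIn-liftStar : ∀ σ s a b → edgeIn (liftStar σ s) a b ≡ edgeIn s (π a) (π b) ∧ (onImage σ a ∧ onImage σ b)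
  edgeIn-liftStar σ s a b
    rewrite ι≟ σ (centre s) a | ι≟ σ (centre s) b
          | lookup∘tabulate (λ a → lookup (leaves s) (π a) ∧ onImage σ a) a
          | lookup∘tabulate (λ a → lookup (leaves s) (π a) ∧ onImage σ a) b
    = solve 6 (λ ca cb la lb ia ib → ((ca :* ia) :* (lb :* ib)) :+ ((cb :* ib) :* (la :* ia))
                                     := ((ca :* lb) :+ (cb :* la)) :* (ia :* ib))
            refl (does (centre s ≟ π a)) (does (centre s ≟ π b))
            (lookup (leaves s) (π a)) (lookup (leaves s) (π b)) (onImage σ a) (onImage σ b)

  vertexIn-liftStar : ∀ σ s a → vertexIn (liftStar σ s) a ≡ vertexIn s (π a) ∧ onImage σ a
  vertexIn-liftStar σ s a
    rewrite ι≟ σ (centre s) a | lookup∘tabulate (λ a → lookup (leaves s) (π a) ∧ onImage σ a) a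
    = sym (∧-distribʳ-∨ (onImage σ a) (does (centre s ≟ π a)) (lookup (leaves s) (π a)))

  ∣liftStar∣ : ∀ σ s → ∣ leaves (liftStar σ s) ∣ ≡ ∣ leaves s ∣
  ∣liftStar∣ σ s = begin
    ∣ leaves (liftStar σ s) ∣
      ≡⟨ ∣p∣≡∑ (leaves (liftStar σ s)) ⟩
    ∑[ a < n G′ ] 𝟙 (lookup (leaves (liftStar σ s)) a)
      ≡⟨ sum-cong-≗ fibre ⟨
    ∑[ a < n G′ ] ∑[ x < n G ] 𝟙 (does (ι σ x ≟ a) ∧ L x)
      ≡⟨ ∑-comm (λ a x → 𝟙 (does (ι σ x ≟ a) ∧ L x)) ⟩
    ∑[ x < n G ] ∑[ a < n G′ ] 𝟙 (does (ι σ x ≟ a) ∧ L x)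
      ≡⟨ sum-cong-≗ (λ x → ∑-δʳ (ι σ x) (λ _ → L x)) ⟩
    ∑[ x < n G ] 𝟙 (L x)
      ≡⟨ ∣p∣≡∑ (leaves s) ⟨
    ∣ leaves s ∣
      ∎
    where
    open ≡-Reasoning
    L = lookup (leaves s)
    fibre : ∀ a → ∑[ x < n G ] 𝟙 (does (ι σ x ≟ a) ∧ L x) ≡ 𝟙 (lookup (leaves (liftStar σ s)) a)
    fibre a = begin
      ∑[ x < n G ] 𝟙 (does (ι σ x ≟ a) ∧ L x)
        ≡⟨ sum-cong-≗ (λ x → cong 𝟙 (trans (cong (_∧ L x) (ι≟ σ x a)) (∧-assoc (does (x ≟ π a)) _ (L x)))) ⟩
      ∑[ x < n G ] 𝟙 (does (x ≟ π a) ∧ (onImage σ a ∧ L x))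
        ≡⟨ ∑-δ (π a) (λ x → onImage σ a ∧ L x) ⟩
      𝟙 (onImage σ a ∧ L (π a))
        ≡⟨ cong 𝟙 (∧-comm (onImage σ a) (L (π a))) ⟩
      𝟙 (L (π a) ∧ onImage σ a)
        ≡⟨ cong 𝟙 (lookup∘tabulate (λ a → L (π a) ∧ onImage σ a) a) ⟨
      𝟙 (lookup (leaves (liftStar σ s)) a)
        ∎

  liftStar-isStarIn : ∀ σ s → CentreNotLeaf s →
                      (∀ y → lookup (leaves s) y ≡ true → adj G′ (ι σ (centre s)) (ι σ y) ≡ true) →
                      IsStarIn G′ (liftStar σ s)
  liftStar-isStarIn σ s c∉L leaf⇒adj = centre∉L′ , leaf⇒adj′
    where
    centre∉L′ : lookup (leaves (liftStar σ s)) (ι σ (centre s)) ≡ false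
    centre∉L′ rewrite lookup∘tabulate (λ a → lookup (leaves s) (π a) ∧ onImage σ a) (ι σ (centre s))
                    | π∘ι σ (centre s) | c∉L = refl
    leaf⇒adj′ : ∀ b → lookup (leaves (liftStar σ s)) b ≡ true → adj G′ (ι σ (centre s)) b ≡ true
    leaf⇒adj′ b b∈L′
      with ∧-true⁻ (trans (sym (lookup∘tabulate (λ a → lookup (leaves s) (π a) ∧ onImage σ a) b)) b∈L′)
    ... | πb∈L , ιπb≡b =
      subst (λ z → adj G′ (ι σ (centre s)) z ≡ true) (does-true⁻ (ι σ (π b) ≟ b) ιπb≡b) (leaf⇒adj (π b) πb∈L)

  ι-adj : ∀ σ s → IsStarIn G′ (liftStar σ s) → ∀ {x y} → edgeIn s x y ≡ true → adj G′ (ι σ x) (ι σ y) ≡ true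
  ι-adj σ s st {x} {y} e = edgeIn⇒adj undirected′ (liftStar σ s) st lifted
    where
    lifted : edgeIn (liftStar σ s) (ι σ x) (ι σ y) ≡ true
    lifted rewrite edgeIn-liftStar σ s (ι σ x) (ι σ y) | onImage-ι σ x | onImage-ι σ y
                 | π∘ι σ x | π∘ι σ y | e = refl

  edgeIn-liftStar-adj : ∀ σ s → IsStarIn G′ (liftStar σ s) → ∀ {a b} → adj G′ a b ≡ true →
                        edgeIn (liftStar σ s) a b ≡ edgeIn s (π a) (π b)
  edgeIn-liftStar-adj σ s st {a} {b} ab rewrite edgeIn-liftStar σ s a b with edgeIn s (π a) (π b) in e
  ... | false = refl
  ... | true with lift-unique (ι-adj σ s st e) ab (π∘ι σ (π a)) (π∘ι σ (π b))
  ...   | ιπa≡a , ιπb≡b rewrite dec-true (ι σ (π a) ≟ a) ιπa≡a | dec-true (ι σ (π b) ≟ b) ιπb≡b = refl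

  -- Sections are attached to positions, not to stars: equal stars may be lifted differently.
  liftAll : List (Section × Star (n G)) → List (Star (n G′))
  liftAll = map (uncurry liftStar)

  pull-decomposition : ∀ {Q} → All (IsStarIn G′ ∘ uncurry liftStar) Q → IsStarDecomposition G (map proj₂ Q) →
                       IsStarDecomposition G′ (liftAll Q)
  pull-decomposition {Q} stars (_ , mult≡1) = All.map⁺ stars , mult≡1′
    where
    mult≡1′ : ∀ a b → adj G′ a b ≡ true → edgeMult (liftAll Q) a b ≡ 1
    mult≡1′ a b ab =
      trans (edgeMult-map (uncurry liftStar) proj₂ (All.map (λ {(σ , s)} st → edgeIn-liftStar-adj σ s st ab) stars))
            (mult≡1 (π a) (π b) (π-adj ab))

  wgt-liftAll : ∀ Q → wgt (liftAll Q) ≡ wgt (map proj₂ Q)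
  wgt-liftAll []            = refl
  wgt-liftAll ((σ , s) ∷ Q) = cong₂ (λ l w → suc l + w) (∣liftStar∣ σ s) (wgt-liftAll Q)

-- Exclusive vertex splits

module ExclusiveSplit (G : Graph) (simple : IsSimple G) (v : Fin (n G)) (S : Subset (n G)) where

  private
    loopless : Loopless G
    loopless = proj₁ simple

    undirected : Undirected G
    undirected = proj₂ simple

  unsplit : Fin (suc (n G)) → Fin (n G)
  unsplit zero    = v
  unsplit (suc x) = x

  -- The endpoint over x of the edge of the split graph lying over the edge xy.
  liftVertex : Fin (n G) → Fin (n G) → Fin (suc (n G))
  liftVertex x y = if does (x ≟ v) ∧ lookup S y then zero else suc x

  splitAdj-suc : ∀ {x y} → x ≢ v → y ≢ v → splitAdj G v S (suc x) (suc y) ≡ adj G x y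
  splitAdj-suc {x} {y} x≢v y≢v rewrite dec-false (x ≟ v) x≢v | dec-false (y ≟ v) y≢v = refl

  splitAdj-v : ∀ y → splitAdj G v S (suc v) (suc y) ≡ adj G v y ∧ not (lookup S y)
  splitAdj-v y rewrite dec-true (v ≟ v) refl = refl

  split-loopless : Loopless (split G v S)
  split-loopless zero    = refl
  split-loopless (suc x) with x ≟ v
  ... | yes refl = cong (_∧ not (lookup S v)) (loopless v)
  ... | no  _    = loopless x

  split-undirected : Undirected (split G v S)
  split-undirected zero    zero    = refl
  split-undirected zero    (suc y) = refl
  split-undirected (suc x) zero    = refl
  split-undirected (suc x) (suc y) with x ≟ v | y ≟ v
  ... | yes refl | yes refl = refl
  ... | yes refl | no  _    = cong (_∧ not (lookup S y)) (undirected v y)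
  ... | no  _    | yes refl = cong (_∧ not (lookup S x)) (undirected x v)
  ... | no  _    | no  _    = undirected x y

  split-simple : IsSimple (split G v S)
  split-simple = split-loopless , split-undirected

  unsplit-adj : ∀ {a b} → splitAdj G v S a b ≡ true → adj G (unsplit a) (unsplit b) ≡ true
  unsplit-adj {zero}  {suc y} e = proj₁ (∧-true⁻ e)
  unsplit-adj {suc x} {zero}  e = trans (undirected x v) (proj₁ (∧-true⁻ e))
  unsplit-adj {suc x} {suc y} e with x ≟ v | y ≟ v
  ... | yes refl | _        = proj₁ (∧-true⁻ e)
  ... | no  _    | yes refl = proj₁ (∧-true⁻ e)
  ... | no  _    | no  _    = e

  unsplit-liftVertex : ∀ x y → unsplit (liftVertex x y) ≡ x
  unsplit-liftVertex x y with does (x ≟ v) ∧ lookup S y in e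
  ... | true  = sym (does-true⁻ (x ≟ v) (proj₁ (∧-true⁻ e)))
  ... | false = refl

  liftVertex-adj-v : ∀ {y} → adj G v y ≡ true → splitAdj G v S (liftVertex v y) (liftVertex y v) ≡ true
  liftVertex-adj-v {y} vy rewrite dec-true (v ≟ v) refl | dec-false (y ≟ v) (adj⇒≢ {G} loopless vy ∘ sym)
    with lookup S y in y∈S
  ... | true  rewrite vy | y∈S = refl
  ... | false = trans (splitAdj-v y) (cong₂ _∧_ vy (cong not y∈S))

  liftVertex-adj : ∀ {x y} → adj G x y ≡ true → splitAdj G v S (liftVertex x y) (liftVertex y x) ≡ true
  liftVertex-adj {x} {y} = by-cases (x ≟ v) (y ≟ v)
    where
    by-cases : ∀ {x y} → Dec (x ≡ v) → Dec (y ≡ v) → adj G x y ≡ true →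
               splitAdj G v S (liftVertex x y) (liftVertex y x) ≡ true
    by-cases (yes refl) _          vy = liftVertex-adj-v vy
    by-cases {x} (no _) (yes refl) xv =
      trans (split-undirected (liftVertex x v) (liftVertex v x)) (liftVertex-adj-v (trans (undirected v x) xv))
    by-cases {x} {y} (no x≢v) (no y≢v) xy
      rewrite dec-false (x ≟ v) x≢v | dec-false (y ≟ v) y≢v = trans (splitAdj-suc x≢v y≢v) xy

  adj⇒liftVertex : ∀ {a b} → splitAdj G v S a b ≡ true → a ≡ liftVertex (unsplit a) (unsplit b)
  adj⇒liftVertex {zero} {suc y} e with ∧-true⁻ {adj G v y} e
  ... | _ , y∈S rewrite dec-true (v ≟ v) refl | y∈S = refl
  adj⇒liftVertex {suc x} {zero} e
    rewrite dec-false (x ≟ v) (adj⇒≢ {G} loopless (proj₁ (∧-true⁻ {adj G v x} e)) ∘ sym) = refl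
  adj⇒liftVertex {suc x} {suc y} = by-cases (x ≟ v)
    where
    by-cases : ∀ {x} → Dec (x ≡ v) → splitAdj G v S (suc x) (suc y) ≡ true → suc x ≡ liftVertex x y
    by-cases {x} (no x≢v) _ rewrite dec-false (x ≟ v) x≢v = refl
    by-cases (yes refl) e with ∧-true⁻ {adj G v y} (trans (sym (splitAdj-v y)) e)
    ... | _ , y∉S rewrite dec-true (v ≟ v) refl | Bool.not-injective {lookup S y} {false} y∉S = refl

  splitEdgeBijection : EdgeBijection (split G v S) G
  splitEdgeBijection = record
    { π           = unsplit
    ; π-adj       = λ {a} {b} → unsplit-adj {a} {b}
    ; lift        = λ {x} {y} xy → liftVertex x y , liftVertex y x , liftVertex-adj xy
                                 , unsplit-liftVertex x y , unsplit-liftVertex y x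
    ; lift-unique = λ {a} {b} {a′} {b′} ab a′b′ πa≡πa′ πb≡πb′ →
        unique ab a′b′ πa≡πa′ πb≡πb′ , unique (flip a b ab) (flip a′ b′ a′b′) πb≡πb′ πa≡πa′
    }
    where
    flip : ∀ a b → splitAdj G v S a b ≡ true → splitAdj G v S b a ≡ true
    flip a b ab = trans (split-undirected b a) ab
    unique : ∀ {a b a′ b′} → splitAdj G v S a b ≡ true → splitAdj G v S a′ b′ ≡ true →
             unsplit a ≡ unsplit a′ → unsplit b ≡ unsplit b′ → a ≡ a′
    unique {a} {b} {a′} {b′} ab a′b′ πa≡πa′ πb≡πb′ = begin
      a                               ≡⟨ adj⇒liftVertex ab ⟩
      liftVertex (unsplit a) (unsplit b)    ≡⟨ cong₂ liftVertex πa≡πa′ πb≡πb′ ⟩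
      liftVertex (unsplit a′) (unsplit b′)  ≡⟨ adj⇒liftVertex a′b′ ⟨
      a′                              ∎
      where open ≡-Reasoning

-- Constellations

module _ {H : Graph} (simple : IsSimple H) (constellation : IsConstellation H) where

  private
    c : Fin (n H) → Fin (n H)
    c = proj₁ constellation

    c-idem : ∀ x → c (c x) ≡ c x
    c-idem = proj₁ (proj₂ constellation)

    c-spec : ∀ x y → (adj H x y ≡ true) ⇔ (x ≢ y × c x ≡ c y × (x ≡ c x ⊎ y ≡ c y))
    c-spec = proj₂ (proj₂ constellation)

    isCentre : Fin (n H) → Bool
    isCentre a = does (c a ≟ a)

    starAt : Fin (n H) → Star (n H)
    starAt a = mkStar a (tabulate (adj H a))

    constellationStars : List (Star (n H))
    constellationStars = filterᵇ (isCentre ∘ centre) (List.tabulate starAt)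

    starAt-isStarIn : ∀ a → IsStarIn H (starAt a)
    starAt-isStarIn a = trans (lookup∘tabulate (adj H a) a) (proj₁ simple a)
                      , λ l l∈N → trans (sym (lookup∘tabulate (adj H a) l)) l∈N

    centre-vertexIn : ∀ a u → isCentre a ∧ vertexIn (starAt a) u ≡ does (a ≟ c u)
    centre-vertexIn a u = ⇔→≡ {z = true} (mk⇔ to from)
      where
      to : isCentre a ∧ vertexIn (starAt a) u ≡ true → does (a ≟ c u) ≡ true
      to e with ∧-true⁻ {isCentre a} e
      ... | ca≡a , a∈star = dec-true (a ≟ c u) (trans (sym (does-true⁻ (c a ≟ a) ca≡a)) (same-star (∨-true⁻ a∈star)))
        where
        same-star : does (a ≟ u) ≡ true ⊎ lookup (tabulate (adj H a)) u ≡ true → c a ≡ c u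
        same-star (inj₁ a≡u) = cong c (does-true⁻ (a ≟ u) a≡u)
        same-star (inj₂ u∈N) = proj₁ (proj₂ (Equivalence.to (c-spec a u) (trans (sym (lookup∘tabulate (adj H a) u)) u∈N)))
      from : does (a ≟ c u) ≡ true → isCentre a ∧ vertexIn (starAt a) u ≡ true
      from a≡cu with does-true⁻ (a ≟ c u) a≡cu
      ... | refl rewrite dec-true (c (c u) ≟ c u) (c-idem u) with c u ≟ u
      ...   | yes _    = refl
      ...   | no cu≢u  = trans (lookup∘tabulate (adj H (c u)) u)
                               (Equivalence.from (c-spec (c u) u) (cu≢u , c-idem u , inj₁ (sym (c-idem u))))

    centre-edgeIn : ∀ {x y} → x ≡ c x → adj H x y ≡ true → ∀ a → isCentre a ∧ edgeIn (starAt a) x y ≡ does (a ≟ x)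
    centre-edgeIn {x} {y} x≡cx xy a = ⇔→≡ {z = true} (mk⇔ to from)
      where
      to : isCentre a ∧ edgeIn (starAt a) x y ≡ true → does (a ≟ x) ≡ true
      to e with ∧-true⁻ {isCentre a} e
      ... | ca≡a , a∋xy with edgeIn⁻ (starAt a) a∋xy
      ...   | inj₁ (a≡x , _) = dec-true (a ≟ x) a≡x
      ...   | inj₂ (refl , _) with Equivalence.to (c-spec x a) xy
      ...     | x≢a , cx≡ca , _ = contradiction (trans x≡cx (trans cx≡ca (does-true⁻ (c a ≟ a) ca≡a))) x≢a
      from : does (a ≟ x) ≡ true → isCentre a ∧ edgeIn (starAt a) x y ≡ true
      from a≡x with does-true⁻ (a ≟ x) a≡x
      ... | refl rewrite dec-true (c a ≟ a) (sym x≡cx) =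
        edgeIn⁺ (starAt a) refl (trans (lookup∘tabulate (adj H a) y) xy)

    edgeMult-centre : ∀ {x y} → x ≡ c x → adj H x y ≡ true → edgeMult constellationStars x y ≡ 1
    edgeMult-centre {x} {y} x≡cx xy = begin
      edgeMult constellationStars x y
        ≡⟨ edgeMult≡sum constellationStars x y ⟩
      sum (map (λ s → 𝟙 (edgeIn s x y)) constellationStars)
        ≡⟨ sum-map-𝟙-filter-tabulate _ (λ s → edgeIn s x y) starAt ⟩
      ∑[ a < n H ] 𝟙 (isCentre a ∧ edgeIn (starAt a) x y)
        ≡⟨ sum-cong-≗ (cong 𝟙 ∘ centre-edgeIn x≡cx xy) ⟩
      ∑[ a < n H ] 𝟙 (does (a ≟ x))
        ≡⟨ ∑-𝟙≟ x ⟩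
      1 ∎
      where open ≡-Reasoning

    vertexMult≡1 : ∀ u → vertexMult constellationStars u ≡ 1
    vertexMult≡1 u = begin
      vertexMult constellationStars u
        ≡⟨ sum-map-𝟙-filter-tabulate _ (λ s → vertexIn s u) starAt ⟩
      ∑[ a < n H ] 𝟙 (isCentre a ∧ vertexIn (starAt a) u)
        ≡⟨ sum-cong-≗ (λ a → cong 𝟙 (centre-vertexIn a u)) ⟩
      ∑[ a < n H ] 𝟙 (does (a ≟ c u))
        ≡⟨ ∑-𝟙≟ (c u) ⟩
      1 ∎
      where open ≡-Reasoning

    stars-isStarIn : All (IsStarIn H) constellationStars
    stars-isStarIn = All.filter⁺ (T? ∘ isCentre ∘ centre) (All.tabulate⁺ starAt-isStarIn)

  constellation⇒decomposition : Σ (List (Star (n H))) λ P → IsStarDecomposition H P × wgt P ≡ n H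
  constellation⇒decomposition = constellationStars , (stars-isStarIn , edgeMult≡1) , weight
    where
    edgeMult≡1 : ∀ x y → adj H x y ≡ true → edgeMult constellationStars x y ≡ 1
    edgeMult≡1 x y xy with proj₂ (proj₂ (Equivalence.to (c-spec x y) xy))
    ... | inj₁ x≡cx = edgeMult-centre x≡cx xy
    ... | inj₂ y≡cy = trans (edgeMult-sym constellationStars x y) (edgeMult-centre y≡cy (trans (proj₂ simple y x) xy))
    weight : wgt constellationStars ≡ n H
    weight = begin
      wgt constellationStars                      ≡⟨ ∑-vertexMult≡wgt constellationStars (All.map proj₁ stars-isStarIn) ⟨
      ∑[ u < n H ] vertexMult constellationStars u  ≡⟨ sum-cong-≗ vertexMult≡1 ⟩
      ∑[ u < n H ] 1                              ≡⟨ ∑-1 (n H) ⟩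
      n H                                         ∎
      where open ≡-Reasoning

centreOf : ∀ {n} → List (Star n) → Fin n → Fin n
centreOf []      u = u
centreOf (s ∷ P) u = if vertexIn s u then centre s else centreOf P u

centreOf-∈ : ∀ {n} (P : List (Star n)) u → 1 ≤ vertexMult P u →
             ∃ λ s → s ∈ P × vertexIn s u ≡ true × centreOf P u ≡ centre s
centreOf-∈ (s ∷ P) u pos with vertexIn s u in u∈s
... | true  = s , here refl , u∈s , refl
... | false with centreOf-∈ P u pos
...   | s′ , s′∈P , u∈s′ , c≡ = s′ , there s′∈P , u∈s′ , c≡

centreOf-unique : ∀ {n} (P : List (Star n)) u → vertexMult P u ≡ 1 →
                  ∀ {s} → s ∈ P → vertexIn s u ≡ true → centreOf P u ≡ centre s
centreOf-unique (s ∷ P) u _ (here refl) u∈s rewrite u∈s = refl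
centreOf-unique (s′ ∷ P) u mult≡1 {s} (there s∈P) u∈s with vertexIn s′ u
... | false = centreOf-unique P u mult≡1 s∈P u∈s
... | true  = contradiction (suc-injective mult≡1)
                (n>0⇒n≢0 (≤-trans (≤-reflexive (cong 𝟙 (sym u∈s))) (∈⇒≤sum-map (λ s → 𝟙 (vertexIn s u)) s∈P)))

decomposition⇒constellation : ∀ {G} → IsSimple G → ∀ {P} → IsStarDecomposition G P →
                              (∀ u → vertexMult P u ≡ 1) → IsConstellation G
decomposition⇒constellation {G} (loopless , undirected) {P} decomposition@(stars , _) once =
  c , c-idem , λ x y → mk⇔ to (from x y)
  where
  c : Fin (n G) → Fin (n G)
  c = centreOf P

  home : ∀ u → ∃ λ s → s ∈ P × vertexIn s u ≡ true × c u ≡ centre s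
  home u = centreOf-∈ P u (≤-reflexive (sym (once u)))

  c-unique : ∀ {s u} → s ∈ P → vertexIn s u ≡ true → c u ≡ centre s
  c-unique {u = u} = centreOf-unique P u (once u)

  c-idem : ∀ x → c (c x) ≡ c x
  c-idem x with home x
  ... | s , s∈P , _ , cx≡cs rewrite cx≡cs = c-unique s∈P (vertexIn-centre s)

  to : ∀ {x y} → adj G x y ≡ true → x ≢ y × c x ≡ c y × (x ≡ c x ⊎ y ≡ c y)
  to {x} {y} xy with decomposition⇒edgeIn decomposition xy
  ... | s , s∈P , e = adj⇒≢ loopless xy , trans cx≡cs (sym cy≡cs) , ends (edgeIn⁻ s e)
    where
    cx≡cs = c-unique s∈P (edgeIn⇒vertexIn s x y e)
    cy≡cs = c-unique s∈P (edgeIn⇒vertexIn s y x (trans (edgeIn-sym s y x) e))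
    ends : (centre s ≡ x × _) ⊎ (centre s ≡ y × _) → x ≡ c x ⊎ y ≡ c y
    ends (inj₁ (cs≡x , _)) = inj₁ (sym (trans cx≡cs cs≡x))
    ends (inj₂ (cs≡y , _)) = inj₂ (sym (trans cy≡cs cs≡y))

  centre-adj : ∀ {x y} → x ≢ y → c x ≡ c y → x ≡ c x → adj G x y ≡ true
  centre-adj {x} {y} x≢y cx≡cy x≡cx with home y
  ... | s , s∈P , y∈s , cy≡cs = subst (λ z → adj G z y ≡ true) cs≡x
                                      (proj₂ (All.lookup stars s∈P) y (vertexIn-leaf s y∈s (x≢y ∘ trans (sym cs≡x))))
    where
    cs≡x : centre s ≡ x
    cs≡x = sym (trans x≡cx (trans cx≡cy cy≡cs))

  from : ∀ x y → x ≢ y × c x ≡ c y × (x ≡ c x ⊎ y ≡ c y) → adj G x y ≡ true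
  from x y (x≢y , cx≡cy , inj₁ x≡cx) = centre-adj x≢y cx≡cy x≡cx
  from x y (x≢y , cx≡cy , inj₂ y≡cy) = trans (undirected x y) (centre-adj (x≢y ∘ sym) (sym cx≡cy) y≡cy)

-- Splits versus decompositions

splits⇒decomposition : ∀ {m G H} → IsSimple G → Splits m G H → IsConstellation H →
                       Σ (List (Star (n G))) λ P → IsStarDecomposition G P × wgt P ≤ n G + m
splits⇒decomposition {G = G} simple done constellation with constellation⇒decomposition simple constellation
... | P , decomposition , wgt≡n = P , decomposition , ≤-reflexive (trans wgt≡n (sym (+-identityʳ (n G))))
splits⇒decomposition {suc m} {G} simple (step v S splits) constellation
  with splits⇒decomposition (ExclusiveSplit.split-simple G simple v S) splits constellation
... | P′ , decomposition′ , wgt≤ = map push P′ , push-decomposition decomposition′ , weight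
  where
  open ExclusiveSplit G simple v S
  open Pushforward splitEdgeBijection (proj₁ simple) split-undirected
  weight : wgt (map push P′) ≤ n G + suc m
  weight = begin
    wgt (map push P′) ≤⟨ wgt-push P′ ⟩
    wgt P′            ≤⟨ wgt≤ ⟩
    suc (n G) + m     ≡⟨ +-suc (n G) m ⟨
    n G + suc m       ∎
    where open ≤-Reasoning

module Peel {G : Graph} (simple : IsSimple G) {ps qs : List (Star (n G))} {s₀ : Star (n G)}
            (decomposition : IsStarDecomposition G (ps ++ s₀ ∷ qs)) {v : Fin (n G)} (v∈s₀ : vertexIn s₀ v ≡ true) where

  P : List (Star (n G))
  P = ps ++ s₀ ∷ qs

  -- The new vertex zero takes over v in s₀ (through ρ); all other stars keep suc v.
  S : Subset (n G)
  S = tabulate (edgeIn s₀ v)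

  open ExclusiveSplit G simple v S
  open Pullback splitEdgeBijection split-undirected

  ρ : Fin (n G) → Fin (suc (n G))
  ρ x = if does (x ≟ v) then zero else suc x

  unsplit∘ρ : ∀ x → unsplit (ρ x) ≡ x
  unsplit∘ρ x with x ≟ v
  ... | yes x≡v = sym x≡v
  ... | no  _   = refl

  sucSection ρSection : Section
  sucSection = section suc (λ _ → refl)
  ρSection   = section ρ unsplit∘ρ

  Q : List (Section × Star (n G))
  Q = map (sucSection ,_) ps ++ (ρSection , s₀) ∷ map (sucSection ,_) qs

  P′ : List (Star (suc (n G)))
  P′ = liftAll Q

  sucLifts : List (Star (n G)) → List (Star (suc (n G)))
  sucLifts xs = liftAll (map (sucSection ,_) xs)

  s₀′ : Star (suc (n G))
  s₀′ = liftStar ρSection s₀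

  P′≡ : P′ ≡ sucLifts ps ++ s₀′ ∷ sucLifts qs
  P′≡ = map-++ (uncurry liftStar) (map (sucSection ,_) ps) _

  proj₂-Q : map proj₂ Q ≡ P
  proj₂-Q = trans (map-++ proj₂ (map (sucSection ,_) ps) _)
                  (cong₂ (λ xs ys → xs ++ s₀ ∷ ys) (proj₂-sucSection ps) (proj₂-sucSection qs))
    where
    proj₂-sucSection : ∀ xs → map proj₂ (map (sucSection ,_) xs) ≡ xs
    proj₂-sucSection xs = trans (sym (map-∘ xs)) (map-id xs)

  star : ∀ {s} → s ∈ P → IsStarIn G s
  star = All.lookup (proj₁ decomposition)

  Other : Star (n G) → Set
  Other s = s ∈ ps ⊎ s ∈ qs

  other∈P : ∀ {s} → Other s → s ∈ P
  other∈P (inj₁ s∈ps) = ∈-++⁺ˡ s∈ps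
  other∈P (inj₂ s∈qs) = ∈-++⁺ʳ ps (there s∈qs)

  other-edge : ∀ {s} → Other s → ∀ {x y} → edgeIn s x y ≡ true → edgeIn s₀ x y ≡ false
  other-edge {s} other {x} {y} e = ¬-not λ e₀ → contradiction (≤-trans (twice other e₀) (≤-reflexive once)) λ { (s≤s ()) }
    where
    once : edgeMult ps x y + (𝟙 (edgeIn s₀ x y) + edgeMult qs x y) ≡ 1
    once = trans (sym (edgeMult-++ ps (s₀ ∷ qs) x y))
                 (proj₂ decomposition x y (edgeIn⇒adj (proj₂ simple) s (star (other∈P other)) e))
    member : ∀ {xs} → s ∈ xs → 1 ≤ edgeMult xs x y
    member {xs} s∈xs = ≤-trans (≤-reflexive (cong 𝟙 (sym e)))
                               (subst (_ ≤_) (sym (edgeMult≡sum xs x y)) (∈⇒≤sum-map (λ s → 𝟙 (edgeIn s x y)) s∈xs))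
    twice : Other s → edgeIn s₀ x y ≡ true → 2 ≤ edgeMult ps x y + (𝟙 (edgeIn s₀ x y) + edgeMult qs x y)
    twice (inj₁ s∈ps) e₀ rewrite e₀ = +-mono-≤ (member s∈ps) (s≤s z≤n)
    twice (inj₂ s∈qs) e₀ rewrite e₀ = ≤-trans (s≤s (member s∈qs)) (m≤n+m _ (edgeMult ps x y))

  liftVertex-other : ∀ {x y} → edgeIn s₀ x y ≡ false → liftVertex x y ≡ suc x
  liftVertex-other {x} {y} = by-cases (x ≟ v)
    where
    by-cases : ∀ {x} → Dec (x ≡ v) → edgeIn s₀ x y ≡ false → liftVertex x y ≡ suc x
    by-cases (yes refl) e rewrite dec-true (v ≟ v) refl | lookup∘tabulate (edgeIn s₀ v) y | e = refl
    by-cases {x} (no x≢v) _ rewrite dec-false (x ≟ v) x≢v = refl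

  liftVertex-s₀ : ∀ {x y} → edgeIn s₀ x y ≡ true → liftVertex x y ≡ ρ x
  liftVertex-s₀ {x} {y} = by-cases (x ≟ v)
    where
    by-cases : ∀ {x} → Dec (x ≡ v) → edgeIn s₀ x y ≡ true → liftVertex x y ≡ ρ x
    by-cases (yes refl) e rewrite dec-true (v ≟ v) refl | lookup∘tabulate (edgeIn s₀ v) y | e = refl
    by-cases {x} (no x≢v) _ rewrite dec-false (x ≟ v) x≢v = refl

  liftVertex⇒isStarIn : ∀ σ s → IsStarIn G s → (∀ {x y} → edgeIn s x y ≡ true → liftVertex x y ≡ Section.ι σ x) →
                       IsStarIn (split G v S) (liftStar σ s)
  liftVertex⇒isStarIn σ s (c∉L , leaf⇒adj) lifts = liftStar-isStarIn σ s c∉L λ y y∈L →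
    subst₂ (λ a b → splitAdj G v S a b ≡ true)
           (lifts (edgeIn⁺ s refl y∈L)) (lifts (trans (edgeIn-sym s y (centre s)) (edgeIn⁺ s refl y∈L)))
           (liftVertex-adj (leaf⇒adj y y∈L))

  stars′ : All (IsStarIn (split G v S) ∘ uncurry liftStar) Q
  stars′ = All.++⁺ (others inj₁) (liftVertex⇒isStarIn ρSection s₀ (star (∈-++⁺ʳ ps (here refl))) liftVertex-s₀ ∷ others inj₂)
    where
    others : ∀ {xs} → (∀ {s} → s ∈ xs → Other s) →
             All (IsStarIn (split G v S) ∘ uncurry liftStar) (map (sucSection ,_) xs)
    others other = All.map⁺ (All.tabulate λ {s} s∈xs →
      liftVertex⇒isStarIn sucSection s (star (other∈P (other s∈xs))) (liftVertex-other ∘ other-edge (other s∈xs)))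

  decomposition′ : IsStarDecomposition (split G v S) P′
  decomposition′ = pull-decomposition stars′ (subst (IsStarDecomposition G) (sym proj₂-Q) decomposition)

  wgt′ : wgt P′ ≡ wgt P
  wgt′ = trans (wgt-liftAll Q) (cong wgt proj₂-Q)

  vertexMult-sucLifts : ∀ xs u → vertexMult (sucLifts xs) (suc u) ≡ vertexMult xs u
  vertexMult-sucLifts []       u = refl
  vertexMult-sucLifts (s ∷ xs) u = cong₂ _+_ (cong 𝟙 sucLift) (vertexMult-sucLifts xs u)
    where
    sucLift : vertexIn (liftStar sucSection s) (suc u) ≡ vertexIn s u
    sucLift rewrite vertexIn-liftStar sucSection s (suc u) | dec-true (u ≟ u) refl = ∧-identityʳ _

  vertexIn-s₀′ : ∀ u → 𝟙 (vertexIn s₀′ (suc u)) + 𝟙 (does (u ≟ v)) ≡ 𝟙 (vertexIn s₀ u)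
  vertexIn-s₀′ u rewrite vertexIn-liftStar ρSection s₀ (suc u) = by-cases (u ≟ v)
    where
    by-cases : ∀ {u} → Dec (u ≡ v) →
               𝟙 (vertexIn s₀ u ∧ does (ρ u ≟ suc u)) + 𝟙 (does (u ≟ v)) ≡ 𝟙 (vertexIn s₀ u)
    by-cases (yes refl) rewrite dec-true (v ≟ v) refl | ∧-zeroʳ (vertexIn s₀ v) | v∈s₀ = refl
    by-cases {u} (no u≢v) rewrite dec-false (u ≟ v) u≢v | dec-true (u ≟ u) refl | ∧-identityʳ (vertexIn s₀ u) =
      +-identityʳ _

  vertexMult′-suc : ∀ u → vertexMult P′ (suc u) + 𝟙 (does (u ≟ v)) ≡ vertexMult P u
  vertexMult′-suc u = begin
    vertexMult P′ (suc u) + δ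
      ≡⟨ cong (λ P → vertexMult P (suc u) + δ) P′≡ ⟩
    vertexMult (sucLifts ps ++ s₀′ ∷ sucLifts qs) (suc u) + δ
      ≡⟨ cong (_+ δ) (vertexMult-++ (sucLifts ps) _ (suc u)) ⟩
    (vertexMult (sucLifts ps) (suc u) + (𝟙 (vertexIn s₀′ (suc u)) + vertexMult (sucLifts qs) (suc u))) + δ
      ≡⟨ cong₂ (λ a c → (a + (𝟙 (vertexIn s₀′ (suc u)) + c)) + δ) (vertexMult-sucLifts ps u) (vertexMult-sucLifts qs u) ⟩
    (vertexMult ps u + (𝟙 (vertexIn s₀′ (suc u)) + vertexMult qs u)) + δ
      ≡⟨ +-assoc (vertexMult ps u) _ δ ⟩
    vertexMult ps u + ((𝟙 (vertexIn s₀′ (suc u)) + vertexMult qs u) + δ)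
      ≡⟨ cong (vertexMult ps u +_) (+-comm-middle (𝟙 (vertexIn s₀′ (suc u))) (vertexMult qs u) δ) ⟩
    vertexMult ps u + ((𝟙 (vertexIn s₀′ (suc u)) + δ) + vertexMult qs u)
      ≡⟨ cong (λ b → vertexMult ps u + (b + vertexMult qs u)) (vertexIn-s₀′ u) ⟩
    vertexMult ps u + vertexMult (s₀ ∷ qs) u
      ≡⟨ vertexMult-++ ps (s₀ ∷ qs) u ⟨
    vertexMult P u
      ∎
    where
    open ≡-Reasoning
    δ = 𝟙 (does (u ≟ v))
    +-comm-middle : ∀ a b c → (a + b) + c ≡ (a + c) + b
    +-comm-middle a b c = trans (+-assoc a b c) (trans (cong (a +_) (+-comm b c)) (sym (+-assoc a c b)))

  covered′ : (∀ u → 1 ≤ vertexMult P u) → 1 < vertexMult P v → ∀ a → 1 ≤ vertexMult P′ a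
  covered′ covered v-shared zero = ≤-trans (≤-reflexive (cong 𝟙 (sym zero∈s₀′)))
                                           (∈⇒≤sum-map (λ s → 𝟙 (vertexIn s zero)) s₀′∈P′)
    where
    zero∈s₀′ : vertexIn s₀′ zero ≡ true
    zero∈s₀′ rewrite vertexIn-liftStar ρSection s₀ zero | dec-true (v ≟ v) refl | v∈s₀ = refl
    s₀′∈P′ : s₀′ ∈ P′
    s₀′∈P′ = subst (s₀′ ∈_) (sym P′≡) (∈-++⁺ʳ (sucLifts ps) (here refl))
  covered′ covered v-shared (suc u) with u ≟ v | vertexMult′-suc u
  ... | yes refl | mult′+1≡mult = +-cancelʳ-≤ 1 1 _ (subst (2 ≤_) (sym mult′+1≡mult) v-shared)
  ... | no  _    | mult′+0≡mult = subst (1 ≤_) (trans (sym mult′+0≡mult) (+-identityʳ _)) (covered u)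

peel : ∀ {G} → IsSimple G → ∀ {P} → IsStarDecomposition G P → (∀ u → 1 ≤ vertexMult P u) →
       ∀ {v} → 1 < vertexMult P v →
       ∃₂ λ S P′ → IsStarDecomposition (split G v S) P′ × (∀ a → 1 ≤ vertexMult P′ a) × wgt P′ ≡ wgt P
peel simple {P} decomposition covered {v} v-shared
  with sum-map-𝟙⇒∃ (λ s → vertexIn s v) P (≤-trans (s≤s z≤n) v-shared)
... | s₀ , s₀∈P , v∈s₀ with ∈-∃++ s₀∈P
...   | ps , qs , refl = S , P′ , decomposition′ , covered′ covered v-shared , wgt′
  where open Peel simple decomposition v∈s₀ using (S; P′; decomposition′; covered′; wgt′)

decomposition⇒splits : ∀ f {G} → IsSimple G → ∀ {P} → IsStarDecomposition G P → (∀ u → 1 ≤ vertexMult P u) →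
                        wgt P ≡ n G + f → Σ Graph λ H → Splits f G H × IsConstellation H
decomposition⇒splits zero {G} simple {P} decomposition covered wgt≡n =
  G , done , decomposition⇒constellation simple decomposition (∑≡n⇒≡1 (vertexMult P) covered ∑≡n)
  where
  ∑≡n : ∑[ u < n G ] vertexMult P u ≡ n G
  ∑≡n = trans (decomposition-∑vertexMult decomposition) (trans wgt≡n (+-identityʳ (n G)))
decomposition⇒splits (suc f) {G} simple decomposition covered wgt≡
  with n<wgt⇒shared decomposition (subst (n G <_) (sym wgt≡) (m<m+n (n G) z<s))
... | v , v-shared with peel simple decomposition covered v-shared
...   | S , P′ , decomposition′ , covered′ , wgt′≡ =
  let H , splits , constellation =
        decomposition⇒splits f (ExclusiveSplit.split-simple G simple v S) decomposition′ covered′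
                             (trans wgt′≡ (trans wgt≡ (+-suc (n G) f)))
  in H , step v S splits , constellation

corollary1 : (G : Graph) → IsSimple G → NoIsolated G →
    (k : ℕ) → 1 ≤ k →
    (Σ ℕ λ m → Σ Graph λ H → m ≤ k × Splits m G H × IsConstellation H)
    ⇔
    (Σ (List (Star (n G))) λ P → IsStarDecomposition G P × wgt P ≤ n G + k)
corollary1 G simple noIsolated k _ = mk⇔ splits⇒ ⇒splits
  where
  splits⇒ : (Σ ℕ λ m → Σ Graph λ H → m ≤ k × Splits m G H × IsConstellation H) →
            Σ (List (Star (n G))) λ P → IsStarDecomposition G P × wgt P ≤ n G + k
  splits⇒ (m , H , m≤k , splits , constellation) =
    let P , decomposition , wgt≤ = splits⇒decomposition simple splits constellation
    in P , decomposition , ≤-trans wgt≤ (+-monoʳ-≤ (n G) m≤k)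

  ⇒splits : (Σ (List (Star (n G))) λ P → IsStarDecomposition G P × wgt P ≤ n G + k) →
            Σ ℕ λ m → Σ Graph λ H → m ≤ k × Splits m G H × IsConstellation H
  ⇒splits (P , decomposition , wgt≤) =
    let covered = noIsolated⇒covered noIsolated decomposition
        H , splits , constellation = decomposition⇒splits (wgt P ∸ n G) simple decomposition covered
                                                          (sym (m+[n∸m]≡n (covered⇒n≤wgt decomposition covered)))
    in wgt P ∸ n G , H , m≤n+o⇒m∸n≤o (wgt P) (n G) wgt≤ , splits , constellation
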